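{- Let $n>1$ be an integer and let $N=N(n)=\mathrm{Pr}(2^n-1)$ be the primover cofactor of $2^n-1$, and assume $N$ is not a prime (i.e. $N$ is a full overpseudoprime to base 2). Let $\omega(N)$ denote the number of prime divisors of $N$ counted with multiplicity. Then $$\omega(N(n))<\frac{n}{\log_2 n}.$$
   Context: A prime $p$ is a primitive prime divisor of $2^n-1$ if $p\mid 2^n-1$ but $p\nmid 2^j-1$ for all $1\le j<n$ (equivalently, the multiplicative order of $2$ modulo $p$ equals $n$). The primover cofactor $\mathrm{Pr}(2^n-1)$ is the product of all primitive prime divisors of $2^n-1$, each taken with the multiplicity with which it divides $2^n-1$. If $\mathrm{Pr}(2^n-1)$ is not prime, it is called a full overpseudoprime to base 2. -}

module Defs where

open import Data.Nat using (ℕ; _∸_; _^_; _≤_; _≤?_)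
open import Data.Nat.Divisibility using (_∣_; _∣?_)
open import Data.Nat.Primality using (Prime; prime?)
open import Data.Fin using (Fin; toℕ)
open import Data.Fin.Properties using (all?)
open import Data.List using (List; filter; length)
open import Data.Nat.ListAction using (product)
open import Data.Product using (_×_)
open import Relation.Nullary using (¬_; Dec)
open import Relation.Nullary.Decidable using (_×-dec_; _→-dec_; ¬?)

PrimitivePrimeDivisor : ℕ → ℕ → Set
PrimitivePrimeDivisor n p =
  Prime p × (p ∣ 2 ^ n ∸ 1) × ((j : Fin n) → 1 ≤ toℕ j → ¬ (p ∣ 2 ^ toℕ j ∸ 1))

primitive? : (n p : ℕ) → Dec (PrimitivePrimeDivisor n p)
primitive? n p =
  prime? p ×-dec (p ∣? (2 ^ n ∸ 1))
    ×-dec all? (λ j → (1 ≤? toℕ j) →-dec ¬? (p ∣? (2 ^ toℕ j ∸ 1)))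

-- Given the list of prime factors of 2^n - 1 counted with multiplicity
-- (e.g. the factors of a PrimeFactorisation), the primover cofactor Pr(2^n - 1)
-- is the product of those that are primitive prime divisors (keeping multiplicity).
primover : (n : ℕ) → List ℕ → ℕ
primover n fs = product (filter (primitive? n) fs)

{-# OPTIONS --safe #-}
module Submission where

-- Every prime factor q of N is a primitive prime divisor of 2^n - 1, so the
-- order of 2 modulo q is n; since by pigeonhole on the residues of 2^0, …, 2^(q-1)
-- that order is less than q, we get q > n. Hence n^ω(N) ≤ N ≤ 2^n - 1 < 2^n.

open import Defs
open import Data.Nat using (ℕ; zero; suc; pred; _∸_; _^_; _<_; _≤_; _*_; _+_; _%_; _/_; NonZero; ≢-nonZero; z<s)
open import Data.Nat.Properties
open import Data.Nat.Divisibility using (_∣_; divides; ∣-trans; ∣1⇒≡1; ∣m+n∣m⇒∣n; m%n≡0⇒n∣m; m∣m*n)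
open import Data.Nat.DivMod using (m≡m%n+[m/n]*n; m%n<n)
open import Data.Nat.Primality using (Prime; ¬prime[0]; ¬prime[1]; prime⇒nonZero; euclidsLemma)
open import Data.Nat.Primality.Factorisation using (PrimeFactorisation; factors; factorisationHasAllPrimeFactors)
open import Data.Nat.ListAction using (product)
open import Data.Nat.ListAction.Properties using (∈⇒∣product)
open import Data.List using (List; []; _∷_; length; filter)
open import Data.List.Relation.Unary.All as All using (All; []; _∷_)
open import Data.List.Relation.Unary.All.Properties using (all-filter)
open import Data.Fin as Fin using (Fin; toℕ; fromℕ<)
open import Data.Fin.Properties using (pigeonhole; toℕ-fromℕ<; toℕ<n)
open import Data.Product using (∃-syntax; ∃₂; _×_; _,_; proj₁)
open import Data.Sum using (inj₁; inj₂)
open import Data.Bool using (true; false)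
open import Data.Empty using (⊥-elim)
open import Relation.Nullary using (¬_; Dec; does)
open import Relation.Binary.PropositionalEquality
open PrimeFactorisation

%≡⇒∣∸ : ∀ x y n .{{_ : NonZero n}} → x % n ≡ y % n → n ∣ y ∸ x
%≡⇒∣∸ x y n eq = divides (y / n ∸ x / n) (begin
    y ∸ x
  ≡⟨ cong₂ _∸_ (m≡m%n+[m/n]*n y n) (m≡m%n+[m/n]*n x n) ⟩
    (y % n + (y / n) * n) ∸ (x % n + (x / n) * n)
  ≡⟨ cong (λ r → (y % n + (y / n) * n) ∸ (r + (x / n) * n)) eq ⟩
    (y % n + (y / n) * n) ∸ (y % n + (x / n) * n)
  ≡⟨ [m+n]∸[m+o]≡n∸o (y % n) _ _ ⟩
    (y / n) * n ∸ (x / n) * n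
  ≡⟨ *-distribʳ-∸ n (y / n) (x / n) ⟨
    (y / n ∸ x / n) * n ∎)
  where open ≡-Reasoning

^-+∸^ : ∀ a i d → a ^ (i + d) ∸ a ^ i ≡ a ^ i * (a ^ d ∸ 1)
^-+∸^ a i d = begin
    a ^ (i + d) ∸ a ^ i
  ≡⟨ cong₂ _∸_ (^-distribˡ-+-* a i d) (sym (*-identityʳ (a ^ i))) ⟩
    a ^ i * a ^ d ∸ a ^ i * 1
  ≡⟨ *-distribˡ-∸ (a ^ i) (a ^ d) 1 ⟨
    a ^ i * (a ^ d ∸ 1) ∎
  where open ≡-Reasoning

∣^∸1∧∣⇒∣1 : ∀ {d a n} .{{_ : NonZero a}} → 1 ≤ n → d ∣ a ^ n ∸ 1 → d ∣ a → d ∣ 1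
∣^∸1∧∣⇒∣1 {d} {a} {suc n} _ d∣aⁿ∸1 d∣a = ∣m+n∣m⇒∣n d∣[aⁿ∸1]+1 d∣aⁿ∸1
  where
  d∣[aⁿ∸1]+1 : d ∣ (a ^ suc n ∸ 1) + 1
  d∣[aⁿ∸1]+1 = subst (d ∣_) (sym (m∸n+n≡m (m^n>0 a (suc n)))) (∣-trans d∣a (m∣m*n (a ^ n)))

prime∤⇒∤^ : ∀ {p a} → Prime p → ¬ p ∣ a → ∀ k → ¬ p ∣ a ^ k
prime∤⇒∤^ p-prime _ zero p∣1 = ¬prime[1] (subst Prime (∣1⇒≡1 p∣1) p-prime)
prime∤⇒∤^ {a = a} p-prime p∤a (suc k) p∣aᵏ⁺¹ with euclidsLemma a (a ^ k) p-prime p∣aᵏ⁺¹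
... | inj₁ p∣a = p∤a p∣a
... | inj₂ p∣aᵏ = prime∤⇒∤^ p-prime p∤a k p∣aᵏ

-- The p powers a^0, …, a^(p-1) have only p - 1 possible (nonzero) residues modulo p;
-- if a^i ≡ a^j with i < j, then p ∣ a^i (a^(j-i) - 1).
prime∤⇒∣^∸1-below : ∀ {p a} → Prime p → ¬ p ∣ a → ∃[ d ] 1 ≤ d × d < p × p ∣ a ^ d ∸ 1
prime∤⇒∣^∸1-below {zero} p-prime _ = ⊥-elim (¬prime[0] p-prime)
prime∤⇒∣^∸1-below {suc q} {a} p-prime p∤a = from-collision (pigeonhole (n<1+n q) residue)
  where
  r : ℕ → ℕ
  r k = a ^ k % suc q

  r≢0 : ∀ k → r k ≢ 0
  r≢0 k rₖ≡0 = prime∤⇒∤^ p-prime p∤a k (m%n≡0⇒n∣m (a ^ k) (suc q) rₖ≡0)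

  pred-r<q : ∀ k → pred (r k) < q
  pred-r<q k = pred-mono-< {{≢-nonZero (r≢0 k)}} (m%n<n (a ^ k) (suc q))

  residue : Fin (suc q) → Fin q
  residue k = fromℕ< (pred-r<q (toℕ k))

  residue-injective : ∀ i j → residue i ≡ residue j → r (toℕ i) ≡ r (toℕ j)
  residue-injective i j eq = begin
      r (toℕ i)
    ≡⟨ suc-pred (r (toℕ i)) {{≢-nonZero (r≢0 (toℕ i))}} ⟨
      suc (pred (r (toℕ i)))
    ≡⟨ cong suc (trans (sym (toℕ-fromℕ< _)) (trans (cong toℕ eq) (toℕ-fromℕ< _))) ⟩
      suc (pred (r (toℕ j)))
    ≡⟨ suc-pred (r (toℕ j)) {{≢-nonZero (r≢0 (toℕ j))}} ⟩
      r (toℕ j) ∎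
    where open ≡-Reasoning

  from-collision : ∃₂ (λ i j → i Fin.< j × residue i ≡ residue j) →
                   ∃[ d ] 1 ≤ d × d < suc q × suc q ∣ a ^ d ∸ 1
  from-collision (i , j , i<j , eq) = d , m<n⇒0<n∸m i<j , d<p , p∣aᵈ∸1
    where
    d = toℕ j ∸ toℕ i
    d<p : d < suc q
    d<p = ≤-<-trans (m∸n≤m (toℕ j) (toℕ i)) (toℕ<n j)
    aʲ∸aⁱ≡aⁱ*[aᵈ∸1] : a ^ toℕ j ∸ a ^ toℕ i ≡ a ^ toℕ i * (a ^ d ∸ 1)
    aʲ∸aⁱ≡aⁱ*[aᵈ∸1] =
      trans (cong (λ t → a ^ t ∸ a ^ toℕ i) (sym (m+[n∸m]≡n (<⇒≤ i<j)))) (^-+∸^ a (toℕ i) d)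
    p∣aⁱ*[aᵈ∸1] : suc q ∣ a ^ toℕ i * (a ^ d ∸ 1)
    p∣aⁱ*[aᵈ∸1] = subst (suc q ∣_) aʲ∸aⁱ≡aⁱ*[aᵈ∸1]
      (%≡⇒∣∸ (a ^ toℕ i) (a ^ toℕ j) (suc q) (residue-injective i j eq))
    p∣aᵈ∸1 : suc q ∣ a ^ d ∸ 1
    p∣aᵈ∸1 with euclidsLemma (a ^ toℕ i) (a ^ d ∸ 1) p-prime p∣aⁱ*[aᵈ∸1]
    ... | inj₁ p∣aⁱ = ⊥-elim (prime∤⇒∤^ p-prime p∤a (toℕ i) p∣aⁱ)
    ... | inj₂ p∣aᵈ∸1 = p∣aᵈ∸1

primitive⇒n<p : ∀ {n p} → 1 < n → PrimitivePrimeDivisor n p → n < p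
primitive⇒n<p {n} {p} 1<n (p-prime , p∣2ⁿ∸1 , not-earlier) = ≰⇒> p≰n
  where
  p∤2 : ¬ p ∣ 2
  p∤2 p∣2 = ¬prime[1] (subst Prime (∣1⇒≡1 (∣^∸1∧∣⇒∣1 (<⇒≤ 1<n) p∣2ⁿ∸1 p∣2)) p-prime)

  p≰n : ¬ p ≤ n
  p≰n p≤n =
    let d , 1≤d , d<p , p∣2ᵈ∸1 = prime∤⇒∣^∸1-below p-prime p∤2
        d<n = <-≤-trans d<p p≤n
        toℕ-d≡d = toℕ-fromℕ< d<n
    in not-earlier (fromℕ< d<n) (subst (1 ≤_) (sym toℕ-d≡d) 1≤d)
         (subst (λ t → p ∣ 2 ^ t ∸ 1) (sym toℕ-d≡d) p∣2ᵈ∸1)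

^length≤product : ∀ {n} (qs : List ℕ) → All (n ≤_) qs → n ^ length qs ≤ product qs
^length≤product [] [] = ≤-refl
^length≤product (q ∷ qs) (n≤q ∷ n≤qs) = *-mono-≤ n≤q (^length≤product qs n≤qs)

product-filter≤product : ∀ {P : ℕ → Set} (P? : ∀ x → Dec (P x)) xs →
                         All NonZero xs → product (filter P? xs) ≤ product xs
product-filter≤product P? [] [] = ≤-refl
product-filter≤product P? (x ∷ xs) (x≢0 ∷ xs≢0) with does (P? x)
... | true = *-monoʳ-≤ x (product-filter≤product P? xs xs≢0)
... | false = m≤n⇒m≤o*n x {{x≢0}} (product-filter≤product P? xs xs≢0)

lemma1 : (n : ℕ) → 1 < n → (f : PrimeFactorisation (2 ^ n ∸ 1)) →
    ¬ Prime (primover n (factors f)) →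
    (g : PrimeFactorisation (primover n (factors f))) →
    n ^ length (factors g) < 2 ^ n
lemma1 n 1<n f _ g = begin-strict
    n ^ length (factors g)  ≤⟨ ^length≤product (factors g) (All.map <⇒≤ factors>n) ⟩
    product (factors g)     ≡⟨ isFactorisation g ⟨
    N                       ≤⟨ product-filter≤product (primitive? n) (factors f)
                                 (All.map prime⇒nonZero (factorsPrime f)) ⟩
    product (factors f)     ≡⟨ isFactorisation f ⟨
    2 ^ n ∸ 1               <⟨ ∸-monoʳ-< {2 ^ n} {1} {0} z<s (m^n>0 2 n) ⟩
    2 ^ n                   ∎
  where
  open ≤-Reasoning
  N = primover n (factors f)
  primitives : All (PrimitivePrimeDivisor n) (filter (primitive? n) (factors f))
  primitives = all-filter (primitive? n) (factors f)

  factors>n : All (n <_) (factors g)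
  factors>n = All.tabulate λ {q} q∈g →
    let q∣N = subst (q ∣_) (sym (isFactorisation g)) (∈⇒∣product q∈g)
        q∈N = factorisationHasAllPrimeFactors (All.lookup (factorsPrime g) q∈g) q∣N
                (All.map proj₁ primitives)
    in primitive⇒n<p 1<n (All.lookup primitives q∈N)
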